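{- For every (finite, simple) graph $G$, $\pi_f(G)\le 3$; moreover $\pi_f(G)=3$ whenever $G$ contains $K_4$ as a subgraph.
   Context: Two edges of a graph are nonincident if they share no endpoint. A linear ordering of $V(G)$ separates a pair $\{e,e'\}$ of nonincident edges if both endpoints of one edge precede both endpoints of the other. For a positive integer $t$, the $t$-fold separation dimension $\pi_t(G)$ is the minimum length of a list of linear orderings of $V(G)$ (repetitions allowed) such that every pair of nonincident edges of $G$ is separated by at least $t$ orderings in the list (this is $0$ if $G$ has no pair of nonincident edges). The fractional separation dimension is $\pi_f(G)=\liminf_{t\to\infty}\pi_t(G)/t$; equivalently it is the minimum of $a/b$ such that some list of $a$ linear orderings separates every pair of nonincident edges at least $b$ times. -}

module Defs where

open import Data.Nat using (ℕ; zero; suc; _≤_; _*_)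
open import Data.Fin using (Fin; _<_; _<?_)
open import Data.Fin.Permutation using (Permutation′; _⟨$⟩ʳ_)
open import Data.List using (List; []; _∷_; length)
open import Data.Product using (_×_; Σ; ∃; _,_)
open import Data.Sum using (_⊎_)
open import Relation.Nullary using (¬_; Dec; yes; no)
open import Relation.Nullary.Decidable using (_×-dec_; _⊎-dec_)
open import Relation.Binary.PropositionalEquality using (_≡_; _≢_)
open import Level using (0ℓ) renaming (suc to lsuc)

record Graph (n : ℕ) : Set₁ where
  field
    Adj    : Fin n → Fin n → Set
    sym    : ∀ {u v} → Adj u v → Adj v u
    irrefl : ∀ {u} → ¬ Adj u u
open Graph public

-- A linear ordering of Fin n: a bijection sending each vertex to its position.
Ordering : ℕ → Set
Ordering n = Permutation′ n

_≺[_]_ : ∀ {n} → Fin n → Ordering n → Fin n → Set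
u ≺[ σ ] v = (σ ⟨$⟩ʳ u) < (σ ⟨$⟩ʳ v)

≺-dec : ∀ {n} (u : Fin n) (σ : Ordering n) (v : Fin n) → Dec (u ≺[ σ ] v)
≺-dec u σ v = (σ ⟨$⟩ʳ u) <? (σ ⟨$⟩ʳ v)

Separates : ∀ {n} → Ordering n → (a b c d : Fin n) → Set
Separates σ a b c d =
  ((a ≺[ σ ] c × a ≺[ σ ] d) × (b ≺[ σ ] c × b ≺[ σ ] d))
  ⊎ ((c ≺[ σ ] a × c ≺[ σ ] b) × (d ≺[ σ ] a × d ≺[ σ ] b))

separates? : ∀ {n} (σ : Ordering n) (a b c d : Fin n) → Dec (Separates σ a b c d)
separates? σ a b c d =
  ((≺-dec a σ c ×-dec ≺-dec a σ d) ×-dec (≺-dec b σ c ×-dec ≺-dec b σ d))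
  ⊎-dec ((≺-dec c σ a ×-dec ≺-dec c σ b) ×-dec (≺-dec d σ a ×-dec ≺-dec d σ b))

sepCount : ∀ {n} → List (Ordering n) → (a b c d : Fin n) → ℕ
sepCount [] a b c d = zero
sepCount (σ ∷ L) a b c d with separates? σ a b c d
... | yes _ = suc (sepCount L a b c d)
... | no  _ = sepCount L a b c d

NonincidentEdges : ∀ {n} → Graph n → (a b c d : Fin n) → Set
NonincidentEdges G a b c d =
  Adj G a b × Adj G c d × a ≢ c × a ≢ d × b ≢ c × b ≢ d

SeparatesAll : ∀ {n} → Graph n → ℕ → List (Ordering n) → Set
SeparatesAll G t L =
  ∀ a b c d → NonincidentEdges G a b c d → t ≤ sepCount L a b c d

-- (a , b) is admissible: some list of a orderings separates every pair of
-- nonincident edges at least b times (b ≥ 1).  π_f(G) = min { a / b : admissible }.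
Admissible : ∀ {n} → Graph n → ℕ → ℕ → Set
Admissible G a b = 1 ≤ b × Σ (List (Ordering _)) (λ L → length L ≡ a × SeparatesAll G b L)

FracSepDim≤ : ∀ {n} → Graph n → ℕ → ℕ → Set
FracSepDim≤ G p q = ∃ λ a → ∃ λ b → Admissible G a b × a * q ≤ p * b

FracSepDim≥ : ∀ {n} → Graph n → ℕ → ℕ → Set
FracSepDim≥ G p q = ∀ a b → Admissible G a b → p * b ≤ a * q

ContainsK4 : ∀ {n} → Graph n → Set
ContainsK4 {n} G = Σ (Fin 4 → Fin n) λ f →
  (∀ i j → f i ≡ f j → i ≡ j) × (∀ i j → i ≢ j → Adj G (f i) (f j))

-- Every linear ordering of four distinct vertices a, b, c, d separates exactly
-- one of the three splittings ab|cd, ac|bd, ad|bc.  If G contains a K4, all three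
-- splittings of its vertices are pairs of nonincident edges, so a list of a
-- orderings separating every such pair b times has 3b ≤ a.  Conversely, the list
-- of all orderings is invariant under relabelling the vertices, and relabelling
-- by a transposition turns one splitting into another; hence all three are
-- separated equally often, each pair of nonincident edges is separated by at
-- least a third of all orderings, and three copies of that list give π_f(G) ≤ 3.
module Submission where

open import Defs hiding (sym)
open import Data.Empty using (⊥-elim)
open import Data.Fin using (Fin)
open import Data.Fin.Patterns using (0F; 1F; 2F; 3F)
open import Data.Fin.Properties using (<-strictTotalOrder; _≟_; all?)
open import Data.Fin.Permutation
  using (Permutation′; _⟨$⟩ʳ_; _⟨$⟩ˡ_; permutation; id; flip; transpose; inverseˡ; inverseʳ)
open import Data.List
  using (List; []; _∷_; [_]; _++_; length; map; filter; concat; replicate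
        ; cartesianProduct; allFin)
open import Data.List.Properties using (length-++; filter-some; filter-accept; filter-reject)
open import Data.List.Membership.Propositional using (_∈_; lose)
open import Data.List.Membership.Propositional.Properties
  using (∈-map⁺; ∈-cartesianProduct⁺; ∈-allFin)
open import Data.List.Membership.Propositional.Properties.WithK using (unique∧set⇒bag)
open import Data.List.Relation.Unary.Any using (here)
open import Data.List.Relation.Unary.All using ([])
open import Data.List.Relation.Unary.AllPairs using ([]; _∷_)
open import Data.List.Relation.Unary.Unique.Propositional using (Unique)
import Data.List.Relation.Unary.Unique.Propositional.Properties as Unique
open import Data.List.Relation.Binary.Permutation.Propositional using (_↭_)
open import Data.List.Relation.Binary.Permutation.Propositional.Properties
  using (↭-length; filter-↭)
open import Data.List.Relation.Binary.BagAndSetEquality using (∼bag⇒↭)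
open import Data.Nat using (ℕ; zero; suc; _+_; _*_; _≤_; z≤n; s≤s)
open import Data.Nat.Properties
  using (+-suc; +-assoc; +-identityʳ; *-identityʳ; +-mono-≤; ≤-refl; ≤-trans; ≤-reflexive
        ; m≤n⇒m≤1+n; module ≤-Reasoning)
open import Data.Product using (_×_; _,_; proj₁; proj₂; uncurry)
open import Data.Sum using (_⊎_; inj₁; inj₂; [_,_]′) renaming (swap to ⊎-swap)
open import Data.Vec using (Vec; []; _∷_; lookup; tabulate)
import Data.Vec as Vec
open import Data.Vec.Properties
  using (∷-injective; lookup∘tabulate; tabulate∘lookup; tabulate-cong; lookup-map
        ; map-∘; map-cong; map-id)
open import Function using (_∘_)
open import Function.Bundles using (Injection; _⇔_; mk⇔)
open import Function.Properties.Inverse using (↔⇒↣)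
open import Level using (0ℓ)
open import Relation.Binary.Bundles using (StrictTotalOrder)
open import Relation.Binary.Definitions using (tri<; tri≈; tri>)
open import Relation.Binary.PropositionalEquality
  using (_≡_; _≢_; refl; sym; trans; cong; cong₂; subst; ≢-sym; module ≡-Reasoning)
open import Relation.Nullary using (¬_; Dec; yes; no)
open import Relation.Nullary.Decidable using (_×-dec_; _⊎-dec_)
open import Relation.Nullary.Negation using (contradiction)
open import Relation.Unary using (Pred; Decidable)

-- Separates σ a b c d is, by definition, Separated applied to the positions of
-- a, b, c, d under σ.
module Pairings {a ℓ₁ ℓ₂} (O : StrictTotalOrder a ℓ₁ ℓ₂) where
  open StrictTotalOrder O using (_≈_; _<_; _<?_; compare; asym)
    renaming (Carrier to A; trans to <-trans)

  private variable p q r s : A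

  Below : A → A → A → A → Set ℓ₂
  Below p q r s = (p < r × p < s) × (q < r × q < s)

  Separated : A → A → A → A → Set ℓ₂
  Separated p q r s = Below p q r s ⊎ Below r s p q

  separated? : ∀ p q r s → Dec (Separated p q r s)
  separated? p q r s =
    ((p <? r ×-dec p <? s) ×-dec (q <? r ×-dec q <? s))
    ⊎-dec ((r <? p ×-dec r <? q) ×-dec (s <? p ×-dec s <? q))

  separated-swapˡ : Separated p q r s → Separated q p r s
  separated-swapˡ (inj₁ (p<rs , q<rs)) = inj₁ (q<rs , p<rs)
  separated-swapˡ (inj₂ ((r<p , r<q) , (s<p , s<q))) = inj₂ ((r<q , r<p) , (s<q , s<p))

  separated-swapʳ : Separated p q r s → Separated p q s r
  separated-swapʳ (inj₁ ((p<r , p<s) , (q<r , q<s))) = inj₁ ((p<s , p<r) , (q<s , q<r))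
  separated-swapʳ (inj₂ (r<pq , s<pq)) = inj₂ (s<pq , r<pq)

  separated-sym : Separated p q r s → Separated r s p q
  separated-sym = ⊎-swap

  separated-exclusive : Separated p q r s → ¬ Separated p r q s
  separated-exclusive (inj₁ (_ , (q<r , _))) (inj₁ (_ , (r<q , _))) = asym q<r r<q
  separated-exclusive (inj₁ ((_ , p<s) , _)) (inj₂ (_ , (s<p , _))) = asym p<s s<p
  separated-exclusive (inj₂ (_ , (s<p , _))) (inj₁ ((_ , p<s) , _)) = asym p<s s<p
  separated-exclusive (inj₂ ((_ , r<q) , _)) (inj₂ ((_ , q<r) , _)) = asym q<r r<q

  separated-exclusive₁₃ : Separated p q r s → ¬ Separated p s q r
  separated-exclusive₁₃ pq|rs ps|qr = separated-exclusive (separated-swapʳ pq|rs) ps|qr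

  separated-exclusive₂₃ : Separated p r q s → ¬ Separated p s q r
  separated-exclusive₂₃ pr|qs ps|qr =
    separated-exclusive (separated-swapʳ pr|qs) (separated-swapʳ ps|qr)

  Distinct₄ : A → A → A → A → Set ℓ₁
  Distinct₄ p q r s = ¬ p ≈ q × ¬ p ≈ r × ¬ p ≈ s × ¬ q ≈ r × ¬ q ≈ s × ¬ r ≈ s

  SomePairingSeparated : A → A → A → A → Set ℓ₂
  SomePairingSeparated p q r s = Separated p q r s ⊎ Separated p r q s ⊎ Separated p s q r

  Least₃ : A → A → A → Set ℓ₂
  Least₃ x y z = x < y × x < z

  least₃ : ¬ q ≈ r → ¬ q ≈ s → ¬ r ≈ s → Least₃ q r s ⊎ Least₃ r q s ⊎ Least₃ s q r
  least₃ {q} {r} {s} q≉r q≉s r≉s with compare q r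
  ... | tri≈ _ q≈r _ = contradiction q≈r q≉r
  ... | tri< q<r _ _ with compare q s
  ...   | tri< q<s _ _ = inj₁ (q<r , q<s)
  ...   | tri≈ _ q≈s _ = contradiction q≈s q≉s
  ...   | tri> _ _ s<q = inj₂ (inj₂ (s<q , <-trans s<q q<r))
  least₃ {q} {r} {s} q≉r q≉s r≉s | tri> _ _ r<q with compare r s
  ...   | tri< r<s _ _ = inj₂ (inj₁ (r<q , r<s))
  ...   | tri≈ _ r≈s _ = contradiction r≈s r≉s
  ...   | tri> _ _ s<r = inj₂ (inj₂ (<-trans s<r r<q , s<r))

  Least₄ : A → A → A → A → Set ℓ₂
  Least₄ x y z w = x < y × x < z × x < w

  least₄ : Distinct₄ p q r s →
           Least₄ p q r s ⊎ Least₄ q p r s ⊎ Least₄ r p q s ⊎ Least₄ s p q r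
  least₄ {p} {q} {r} {s} (p≉q , p≉r , p≉s , q≉r , q≉s , r≉s) with least₃ q≉r q≉s r≉s
  ... | inj₁ (q<r , q<s) with compare p q
  ...   | tri< p<q _ _ = inj₁ (p<q , <-trans p<q q<r , <-trans p<q q<s)
  ...   | tri≈ _ p≈q _ = contradiction p≈q p≉q
  ...   | tri> _ _ q<p = inj₂ (inj₁ (q<p , q<r , q<s))
  least₄ {p} {q} {r} {s} (p≉q , p≉r , p≉s , q≉r , q≉s , r≉s) | inj₂ (inj₁ (r<q , r<s))
    with compare p r
  ...   | tri< p<r _ _ = inj₁ (<-trans p<r r<q , p<r , <-trans p<r r<s)
  ...   | tri≈ _ p≈r _ = contradiction p≈r p≉r
  ...   | tri> _ _ r<p = inj₂ (inj₂ (inj₁ (r<p , r<q , r<s)))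
  least₄ {p} {q} {r} {s} (p≉q , p≉r , p≉s , q≉r , q≉s , r≉s) | inj₂ (inj₂ (s<q , s<r))
    with compare p s
  ...   | tri< p<s _ _ = inj₁ (<-trans p<s s<q , <-trans p<s s<r , p<s)
  ...   | tri≈ _ p≈s _ = contradiction p≈s p≉s
  ...   | tri> _ _ s<p = inj₂ (inj₂ (inj₂ (s<p , s<q , s<r)))

  -- The least element is paired with the least of the remaining three.
  least-pairing-separated : Least₄ p q r s → ¬ q ≈ r → ¬ q ≈ s → ¬ r ≈ s →
                            SomePairingSeparated p q r s
  least-pairing-separated (p<q , p<r , p<s) q≉r q≉s r≉s with least₃ q≉r q≉s r≉s
  ... | inj₁ (q<r , q<s) = inj₁ (inj₁ ((p<r , p<s) , (q<r , q<s)))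
  ... | inj₂ (inj₁ (r<q , r<s)) = inj₂ (inj₁ (inj₁ ((p<q , p<s) , (r<q , r<s))))
  ... | inj₂ (inj₂ (s<q , s<r)) = inj₂ (inj₂ (inj₁ ((p<q , p<r) , (s<q , s<r))))

  some-pairing-separated : Distinct₄ p q r s → SomePairingSeparated p q r s
  some-pairing-separated distinct@(p≉q , p≉r , p≉s , q≉r , q≉s , r≉s) with least₄ distinct
  ... | inj₁ p-least = least-pairing-separated p-least q≉r q≉s r≉s
  ... | inj₂ (inj₁ q-least) =
    [ inj₁ ∘ separated-swapˡ
    , [ inj₂ ∘ inj₂ ∘ separated-sym , inj₂ ∘ inj₁ ∘ separated-sym ]′ ]′
    (least-pairing-separated q-least p≉r p≉s r≉s)
  ... | inj₂ (inj₂ (inj₁ r-least)) =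
    [ inj₂ ∘ inj₁ ∘ separated-swapˡ
    , [ inj₂ ∘ inj₂ ∘ separated-swapʳ ∘ separated-sym , inj₁ ∘ separated-sym ]′ ]′
    (least-pairing-separated r-least p≉q p≉s q≉s)
  ... | inj₂ (inj₂ (inj₂ s-least)) =
    [ inj₂ ∘ inj₂ ∘ separated-swapˡ
    , [ inj₂ ∘ inj₁ ∘ separated-swapʳ ∘ separated-sym
      , inj₁ ∘ separated-swapʳ ∘ separated-sym ]′ ]′
    (least-pairing-separated s-least p≉q p≉r q≉r)

count : ∀ {A : Set} {P : Pred A 0ℓ} → Decidable P → List A → ℕ
count P? = length ∘ filter P?

module _ {A : Set} {P : Pred A 0ℓ} (P? : Decidable P) where

  count-↭ : {xs ys : List A} → xs ↭ ys → count P? xs ≡ count P? ys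
  count-↭ = ↭-length ∘ filter-↭ P?

  count-map : ∀ {B : Set} (f : B → A) xs → count P? (map f xs) ≡ count (P? ∘ f) xs
  count-map f [] = refl
  count-map f (x ∷ xs) with P? (f x)
  ... | yes _ = cong suc (count-map f xs)
  ... | no _ = count-map f xs

  count-mono : ∀ {Q : Pred A 0ℓ} (Q? : Decidable Q) → (∀ x → Q x → P x) →
               ∀ xs → count Q? xs ≤ count P? xs
  count-mono Q? Q⇒P [] = z≤n
  count-mono Q? Q⇒P (x ∷ xs) with Q? x | P? x
  ... | yes _ | yes _ = s≤s (count-mono Q? Q⇒P xs)
  ... | yes q | no ¬p = contradiction (Q⇒P x q) ¬p
  ... | no _ | yes _ = m≤n⇒m≤1+n (count-mono Q? Q⇒P xs)
  ... | no _ | no _ = count-mono Q? Q⇒P xs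

  -- On a duplicate-free enumeration of A, any bijection f merely permutes the list.
  count-bijection : ∀ {xs} (f g : A → A) → (∀ x → g (f x) ≡ x) → (∀ x → f (g x) ≡ x) →
                    Unique xs → (∀ x → x ∈ xs) → count (P? ∘ f) xs ≡ count P? xs
  count-bijection {xs} f g g∘f f∘g unique complete =
    trans (sym (count-map f xs))
          (count-↭ (∼bag⇒↭ (unique∧set⇒bag map-unique unique same-elements)))
    where
    map-unique : Unique (map f xs)
    map-unique = Unique.map⁺
      (λ {x} {y} fx≡fy → trans (sym (g∘f x)) (trans (cong g fx≡fy) (g∘f y))) unique
    same-elements : ∀ {x} → x ∈ map f xs ⇔ x ∈ xs
    same-elements {x} = mk⇔ (λ _ → complete x)
      (λ _ → subst (_∈ map f xs) (f∘g x) (∈-map⁺ f (complete (g x))))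

module _ {A : Set} where

  vectors : List A → ∀ k → List (Vec A k)
  vectors xs zero = [ [] ]
  vectors xs (suc k) = map (uncurry _∷_) (cartesianProduct xs (vectors xs k))

  vectors-unique : ∀ {xs} k → Unique xs → Unique (vectors xs k)
  vectors-unique zero _ = [] ∷ []
  vectors-unique (suc k) unique = Unique.map⁺ (uncurry (cong₂ _,_) ∘ ∷-injective)
    (Unique.cartesianProduct⁺ unique (vectors-unique k unique))

  ∈-vectors : ∀ {xs} → (∀ x → x ∈ xs) → ∀ {k} (v : Vec A k) → v ∈ vectors xs k
  ∈-vectors complete [] = here refl
  ∈-vectors complete (x ∷ v) =
    ∈-map⁺ (uncurry _∷_) (∈-cartesianProduct⁺ (complete x) (∈-vectors complete v))

3*n≡n+n+n : ∀ n → 3 * n ≡ n + n + n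
3*n≡n+n+n n = trans (cong (λ m → n + (n + m)) (+-identityʳ n)) (sym (+-assoc n n n))

length-copies : ∀ {A : Set} k (xs : List A) →
                length (concat (replicate k xs)) ≡ k * length xs
length-copies zero xs = refl
length-copies (suc k) xs = trans (length-++ xs) (cong (length xs +_) (length-copies k xs))

module _ {n : ℕ} where
  open Pairings (<-strictTotalOrder n)

  private variable a b c d : Fin n

  ordering-injective : (σ : Ordering n) {u v : Fin n} → σ ⟨$⟩ʳ u ≡ σ ⟨$⟩ʳ v → u ≡ v
  ordering-injective σ = Injection.injective (↔⇒↣ σ)

  positions-distinct : (σ : Ordering n) → Distinct₄ a b c d →
                       Distinct₄ (σ ⟨$⟩ʳ a) (σ ⟨$⟩ʳ b) (σ ⟨$⟩ʳ c) (σ ⟨$⟩ʳ d)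
  positions-distinct σ (a≢b , a≢c , a≢d , b≢c , b≢d , c≢d) =
    a≢b ∘ inj , a≢c ∘ inj , a≢d ∘ inj , b≢c ∘ inj , b≢d ∘ inj , c≢d ∘ inj
    where
    inj : ∀ {u v} → σ ⟨$⟩ʳ u ≡ σ ⟨$⟩ʳ v → u ≡ v
    inj = ordering-injective σ

  sepCount-pairings : (L : List (Ordering n)) → Distinct₄ a b c d →
    sepCount L a b c d + sepCount L a c b d + sepCount L a d b c ≡ length L
  sepCount-pairings [] _ = refl
  sepCount-pairings {a} {b} {c} {d} (σ ∷ L) distinct
    with separates? σ a b c d | separates? σ a c b d | separates? σ a d b c
  ... | yes ab|cd | yes ac|bd | _ = contradiction ac|bd (separated-exclusive ab|cd)
  ... | yes ab|cd | _ | yes ad|bc = contradiction ad|bc (separated-exclusive₁₃ ab|cd)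
  ... | _ | yes ac|bd | yes ad|bc = contradiction ad|bc (separated-exclusive₂₃ ac|bd)
  ... | yes _ | no _ | no _ = cong suc (sepCount-pairings L distinct)
  ... | no _ | yes _ | no _ =
    trans (cong (_+ sepCount L a d b c) (+-suc (sepCount L a b c d) (sepCount L a c b d)))
          (cong suc (sepCount-pairings L distinct))
  ... | no _ | no _ | yes _ =
    trans (+-suc (sepCount L a b c d + sepCount L a c b d) (sepCount L a d b c))
          (cong suc (sepCount-pairings L distinct))
  ... | no ¬ab|cd | no ¬ac|bd | no ¬ad|bc =
    ⊥-elim ([ ¬ab|cd , [ ¬ac|bd , ¬ad|bc ]′ ]′
              (some-pairing-separated (positions-distinct σ distinct)))

  sepCount-cong : ∀ L {a′ b′ c′ d′} → a ≡ a′ → b ≡ b′ → c ≡ c′ → d ≡ d′ →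
                  sepCount L a b c d ≡ sepCount L a′ b′ c′ d′
  sepCount-cong L refl refl refl refl = refl

  sepCount-++ : ∀ (L M : List (Ordering n)) →
                sepCount (L ++ M) a b c d ≡ sepCount L a b c d + sepCount M a b c d
  sepCount-++ [] M = refl
  sepCount-++ {a} {b} {c} {d} (σ ∷ L) M with separates? σ a b c d
  ... | yes _ = cong suc (sepCount-++ L M)
  ... | no _ = sepCount-++ L M

  sepCount-copies : ∀ k (L : List (Ordering n)) →
                    sepCount (concat (replicate k L)) a b c d ≡ k * sepCount L a b c d
  sepCount-copies zero L = refl
  sepCount-copies {a} {b} {c} {d} (suc k) L =
    trans (sepCount-++ L _) (cong (sepCount L a b c d +_) (sepCount-copies k L))

  nonincident-distinct : (G : Graph n) → NonincidentEdges G a b c d → Distinct₄ a b c d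
  nonincident-distinct G (ab , cd , a≢c , a≢d , b≢c , b≢d) =
    (λ { refl → irrefl G ab }) , a≢c , a≢d , b≢c , b≢d , (λ { refl → irrefl G cd })

  containsK4⇒3*t≤length : (G : Graph n) {t : ℕ} (L : List (Ordering n)) →
                          ContainsK4 G → SeparatesAll G t L → 3 * t ≤ length L
  containsK4⇒3*t≤length G {t} L (f , f-injective , f-adjacent) separatesAll = begin
    3 * t
      ≡⟨ 3*n≡n+n+n t ⟩
    t + t + t
      ≤⟨ +-mono-≤ (+-mono-≤ ab|cd ac|bd) ad|bc ⟩
    sepCount L A B C D + sepCount L A C B D + sepCount L A D B C
      ≡⟨ sepCount-pairings L distinct ⟩
    length L ∎
    where
    open ≤-Reasoning
    A = f 0F
    B = f 1F
    C = f 2F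
    D = f 3F
    image-distinct : ∀ i j → i ≢ j → f i ≢ f j
    image-distinct i j i≢j = i≢j ∘ f-injective i j
    A≢B = image-distinct 0F 1F (λ ())
    A≢C = image-distinct 0F 2F (λ ())
    A≢D = image-distinct 0F 3F (λ ())
    B≢C = image-distinct 1F 2F (λ ())
    B≢D = image-distinct 1F 3F (λ ())
    C≢D = image-distinct 2F 3F (λ ())
    distinct : Distinct₄ A B C D
    distinct = A≢B , A≢C , A≢D , B≢C , B≢D , C≢D
    ab|cd = separatesAll A B C D
      (f-adjacent 0F 1F (λ ()) , f-adjacent 2F 3F (λ ()) , A≢C , A≢D , B≢C , B≢D)
    ac|bd = separatesAll A C B D
      (f-adjacent 0F 2F (λ ()) , f-adjacent 1F 3F (λ ()) , A≢B , A≢D , ≢-sym B≢C , C≢D)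
    ad|bc = separatesAll A D B C
      (f-adjacent 0F 3F (λ ()) , f-adjacent 1F 2F (λ ()) , A≢B , A≢C , ≢-sym B≢D , ≢-sym C≢D)

  fracSepDim≥3 : (G : Graph n) → ContainsK4 G → FracSepDim≥ G 3 1
  fracSepDim≥3 G k4 a b (_ , L , refl , separatesAll) =
    subst (3 * b ≤_) (sym (*-identityʳ (length L))) (containsK4⇒3*t≤length G L k4 separatesAll)

  transpose-matchˡ : ∀ (i j : Fin n) → transpose i j ⟨$⟩ʳ i ≡ j
  transpose-matchˡ i j with i ≟ i
  ... | yes _ = refl
  ... | no i≢i = contradiction refl i≢i

  transpose-matchʳ : ∀ (i j : Fin n) → transpose i j ⟨$⟩ʳ j ≡ i
  transpose-matchʳ i j with j ≟ i
  ... | yes j≡i = j≡i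
  ... | no _ with j ≟ j
  ...   | yes _ = refl
  ...   | no j≢j = contradiction refl j≢j

  transpose-fix : ∀ {i j k : Fin n} → k ≢ i → k ≢ j → transpose i j ⟨$⟩ʳ k ≡ k
  transpose-fix {i} {j} {k} k≢i k≢j with k ≟ i
  ... | yes k≡i = contradiction k≡i k≢i
  ... | no _ with k ≟ j
  ...   | yes k≡j = contradiction k≡j k≢j
  ...   | no _ = refl

  -- Orderings are built from functions, so the list of all of them is obtained by
  -- filtering the finitely many candidate tables (pos , vtx): pos lists the
  -- position of each vertex and vtx the vertex at each position.
  Table : Set
  Table = Vec (Fin n) n × Vec (Fin n) n

  IsOrdering : Table → Set
  IsOrdering (pos , vtx) =
    (∀ u → lookup vtx (lookup pos u) ≡ u) × (∀ i → lookup pos (lookup vtx i) ≡ i)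

  isOrdering? : Decidable IsOrdering
  isOrdering? (pos , vtx) =
    all? (λ u → lookup vtx (lookup pos u) ≟ u) ×-dec all? (λ i → lookup pos (lookup vtx i) ≟ i)

  toOrdering : (t : Table) → IsOrdering t → Ordering n
  toOrdering (pos , vtx) (vtx∘pos , pos∘vtx) =
    permutation (lookup pos) (lookup vtx) pos∘vtx vtx∘pos

  toTable : Ordering n → Table
  toTable σ = tabulate (σ ⟨$⟩ʳ_) , tabulate (σ ⟨$⟩ˡ_)

  toTable-isOrdering : ∀ σ → IsOrdering (toTable σ)
  toTable-isOrdering σ = from∘to , to∘from
    where
    open ≡-Reasoning
    from∘to : ∀ u → lookup (tabulate (σ ⟨$⟩ˡ_)) (lookup (tabulate (σ ⟨$⟩ʳ_)) u) ≡ u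
    from∘to u = begin
      lookup (tabulate (σ ⟨$⟩ˡ_)) (lookup (tabulate (σ ⟨$⟩ʳ_)) u)
        ≡⟨ lookup∘tabulate (σ ⟨$⟩ˡ_) _ ⟩
      σ ⟨$⟩ˡ lookup (tabulate (σ ⟨$⟩ʳ_)) u
        ≡⟨ cong (σ ⟨$⟩ˡ_) (lookup∘tabulate (σ ⟨$⟩ʳ_) u) ⟩
      σ ⟨$⟩ˡ (σ ⟨$⟩ʳ u)
        ≡⟨ inverseˡ σ ⟩
      u ∎
    to∘from : ∀ i → lookup (tabulate (σ ⟨$⟩ʳ_)) (lookup (tabulate (σ ⟨$⟩ˡ_)) i) ≡ i
    to∘from i = begin
      lookup (tabulate (σ ⟨$⟩ʳ_)) (lookup (tabulate (σ ⟨$⟩ˡ_)) i)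
        ≡⟨ lookup∘tabulate (σ ⟨$⟩ʳ_) _ ⟩
      σ ⟨$⟩ʳ lookup (tabulate (σ ⟨$⟩ˡ_)) i
        ≡⟨ cong (σ ⟨$⟩ʳ_) (lookup∘tabulate (σ ⟨$⟩ˡ_) i) ⟩
      σ ⟨$⟩ʳ (σ ⟨$⟩ˡ i)
        ≡⟨ inverseʳ σ ⟩
      i ∎

  tables : List Table
  tables = cartesianProduct (vectors (allFin n) n) (vectors (allFin n) n)

  tables-unique : Unique tables
  tables-unique = Unique.cartesianProduct⁺ vectors-unique′ vectors-unique′
    where
    vectors-unique′ : Unique (vectors (allFin n) n)
    vectors-unique′ = vectors-unique n (Unique.allFin⁺ n)

  ∈-tables : ∀ t → t ∈ tables
  ∈-tables (pos , vtx) = ∈-cartesianProduct⁺ (∈-vectors ∈-allFin pos) (∈-vectors ∈-allFin vtx)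

  orderingsOf : List Table → List (Ordering n)
  orderingsOf [] = []
  orderingsOf (t ∷ ts) with isOrdering? t
  ... | yes o = toOrdering t o ∷ orderingsOf ts
  ... | no _ = orderingsOf ts

  allOrderings : List (Ordering n)
  allOrderings = orderingsOf tables

  length-orderingsOf : ∀ ts → length (orderingsOf ts) ≡ count isOrdering? ts
  length-orderingsOf [] = refl
  length-orderingsOf (t ∷ ts) with isOrdering? t
  ... | yes o = trans (cong suc (length-orderingsOf ts))
                      (cong length (sym (filter-accept isOrdering? o)))
  ... | no ¬o = trans (length-orderingsOf ts)
                      (cong length (sym (filter-reject isOrdering? ¬o)))

  allOrderings-nonempty : 1 ≤ length allOrderings
  allOrderings-nonempty = subst (1 ≤_) (sym (length-orderingsOf tables))
    (filter-some isOrdering? (lose (∈-tables (toTable id)) (toTable-isOrdering id)))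

  SeparatesAt : Fin n → Fin n → Fin n → Fin n → Table → Set
  SeparatesAt a b c d t@(pos , _) =
    IsOrdering t × Separated (lookup pos a) (lookup pos b) (lookup pos c) (lookup pos d)

  separatesAt? : ∀ a b c d → Decidable (SeparatesAt a b c d)
  separatesAt? a b c d t@(pos , _) =
    isOrdering? t ×-dec separated? (lookup pos a) (lookup pos b) (lookup pos c) (lookup pos d)

  sepCount-orderingsOf : ∀ ts → sepCount (orderingsOf ts) a b c d ≡ count (separatesAt? a b c d) ts
  sepCount-orderingsOf [] = refl
  sepCount-orderingsOf {a} {b} {c} {d} (t ∷ ts) with isOrdering? t
  ... | no ¬o = trans (sepCount-orderingsOf ts)
                      (cong length (sym (filter-reject (separatesAt? a b c d) (¬o ∘ proj₁))))
  ... | yes o with separates? (toOrdering t o) a b c d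
  ...   | yes s = trans (cong suc (sepCount-orderingsOf ts))
                        (cong length (sym (filter-accept (separatesAt? a b c d) (o , s))))
  ...   | no ¬s = trans (sepCount-orderingsOf ts)
                        (cong length (sym (filter-reject (separatesAt? a b c d) (¬s ∘ proj₂))))

  relabel : Permutation′ n → Table → Table
  relabel π (pos , vtx) = tabulate (lookup pos ∘ (π ⟨$⟩ʳ_)) , Vec.map (π ⟨$⟩ˡ_) vtx

  lookup-relabel : ∀ π t u → lookup (proj₁ (relabel π t)) u ≡ lookup (proj₁ t) (π ⟨$⟩ʳ u)
  lookup-relabel π (pos , _) = lookup∘tabulate (lookup pos ∘ (π ⟨$⟩ʳ_))

  relabel-isOrdering : ∀ π {t} → IsOrdering t → IsOrdering (relabel π t)
  relabel-isOrdering π {t@(pos , vtx)} (vtx∘pos , pos∘vtx) = vtx′∘pos′ , pos′∘vtx′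
    where
    open ≡-Reasoning
    pos′ = proj₁ (relabel π t)
    vtx′ = proj₂ (relabel π t)
    vtx′∘pos′ : ∀ u → lookup vtx′ (lookup pos′ u) ≡ u
    vtx′∘pos′ u = begin
      lookup vtx′ (lookup pos′ u)
        ≡⟨ lookup-map (lookup pos′ u) (π ⟨$⟩ˡ_) vtx ⟩
      π ⟨$⟩ˡ lookup vtx (lookup pos′ u)
        ≡⟨ cong (λ i → π ⟨$⟩ˡ lookup vtx i) (lookup-relabel π t u) ⟩
      π ⟨$⟩ˡ lookup vtx (lookup pos (π ⟨$⟩ʳ u))
        ≡⟨ cong (π ⟨$⟩ˡ_) (vtx∘pos (π ⟨$⟩ʳ u)) ⟩
      π ⟨$⟩ˡ (π ⟨$⟩ʳ u)
        ≡⟨ inverseˡ π ⟩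
      u ∎
    pos′∘vtx′ : ∀ i → lookup pos′ (lookup vtx′ i) ≡ i
    pos′∘vtx′ i = begin
      lookup pos′ (lookup vtx′ i)
        ≡⟨ lookup-relabel π t (lookup vtx′ i) ⟩
      lookup pos (π ⟨$⟩ʳ lookup vtx′ i)
        ≡⟨ cong (λ u → lookup pos (π ⟨$⟩ʳ u)) (lookup-map i (π ⟨$⟩ˡ_) vtx) ⟩
      lookup pos (π ⟨$⟩ʳ (π ⟨$⟩ˡ lookup vtx i))
        ≡⟨ cong (lookup pos) (inverseʳ π) ⟩
      lookup pos (lookup vtx i)
        ≡⟨ pos∘vtx i ⟩
      i ∎

  relabel-inverse : ∀ π t → relabel (flip π) (relabel π t) ≡ t
  relabel-inverse π t@(pos , vtx) = cong₂ _,_ pos-restored vtx-restored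
    where
    pos-restored : tabulate (lookup (proj₁ (relabel π t)) ∘ (π ⟨$⟩ˡ_)) ≡ pos
    pos-restored = trans (tabulate-cong restored) (tabulate∘lookup pos)
      where
      restored : ∀ u → lookup (proj₁ (relabel π t)) (π ⟨$⟩ˡ u) ≡ lookup pos u
      restored u = trans (lookup-relabel π t (π ⟨$⟩ˡ u)) (cong (lookup pos) (inverseʳ π))
    vtx-restored : Vec.map (π ⟨$⟩ʳ_) (Vec.map (π ⟨$⟩ˡ_) vtx) ≡ vtx
    vtx-restored = trans (sym (map-∘ (π ⟨$⟩ʳ_) (π ⟨$⟩ˡ_) vtx))
                         (trans (map-cong (λ _ → inverseʳ π) vtx) (map-id vtx))

  separated-resp : ∀ {p q r s p′ q′ r′ s′ : Fin n} →
                   p ≡ p′ → q ≡ q′ → r ≡ r′ → s ≡ s′ → Separated p q r s → Separated p′ q′ r′ s′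
  separated-resp refl refl refl refl sep = sep

  separatesAt-relabel : ∀ π t →
    SeparatesAt (π ⟨$⟩ʳ a) (π ⟨$⟩ʳ b) (π ⟨$⟩ʳ c) (π ⟨$⟩ʳ d) t → SeparatesAt a b c d (relabel π t)
  separatesAt-relabel {a} {b} {c} {d} π t (o , sep) = relabel-isOrdering π {t} o ,
    separated-resp (moved a) (moved b) (moved c) (moved d) sep
    where
    moved : ∀ u → lookup (proj₁ t) (π ⟨$⟩ʳ u) ≡ lookup (proj₁ (relabel π t)) u
    moved u = sym (lookup-relabel π t u)

  sepCount-relabel : ∀ (π : Permutation′ n) a b c d →
    sepCount allOrderings (π ⟨$⟩ʳ a) (π ⟨$⟩ʳ b) (π ⟨$⟩ʳ c) (π ⟨$⟩ʳ d) ≤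
    sepCount allOrderings a b c d
  sepCount-relabel π a b c d = begin
    sepCount allOrderings (π ⟨$⟩ʳ a) (π ⟨$⟩ʳ b) (π ⟨$⟩ʳ c) (π ⟨$⟩ʳ d)
      ≡⟨ sepCount-orderingsOf tables ⟩
    count (separatesAt? (π ⟨$⟩ʳ a) (π ⟨$⟩ʳ b) (π ⟨$⟩ʳ c) (π ⟨$⟩ʳ d)) tables
      ≤⟨ count-mono (separatesAt? a b c d ∘ relabel π) _ (separatesAt-relabel π) tables ⟩
    count (separatesAt? a b c d ∘ relabel π) tables
      ≡⟨ count-bijection (separatesAt? a b c d) (relabel π) (relabel (flip π))
           (relabel-inverse π) (relabel-inverse (flip π)) tables-unique ∈-tables ⟩
    count (separatesAt? a b c d) tables
      ≡⟨ sepCount-orderingsOf tables ⟨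
    sepCount allOrderings a b c d ∎
    where open ≤-Reasoning

  length-allOrderings≤3*sepCount : Distinct₄ a b c d →
                                   length allOrderings ≤ 3 * sepCount allOrderings a b c d
  length-allOrderings≤3*sepCount {a} {b} {c} {d}
                                 distinct@(a≢b , a≢c , a≢d , b≢c , b≢d , c≢d) = begin
    length allOrderings   ≡⟨ sepCount-pairings allOrderings distinct ⟨
    s₁ + s₂ + s₃          ≤⟨ +-mono-≤ (+-mono-≤ (≤-refl {s₁}) s₂≤s₁) (≤-trans s₃≤s₂ s₂≤s₁) ⟩
    s₁ + s₁ + s₁          ≡⟨ 3*n≡n+n+n s₁ ⟨
    3 * s₁                ∎
    where
    open ≤-Reasoning
    s₁ = sepCount allOrderings a b c d
    s₂ = sepCount allOrderings a c b d
    s₃ = sepCount allOrderings a d b c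
    s₂≤s₁ : s₂ ≤ s₁
    s₂≤s₁ = subst (_≤ s₁)
      (sepCount-cong allOrderings (transpose-fix a≢b a≢c) (transpose-matchˡ b c)
                                  (transpose-matchʳ b c) (transpose-fix (≢-sym b≢d) (≢-sym c≢d)))
      (sepCount-relabel (transpose b c) a b c d)
    s₃≤s₂ : s₃ ≤ s₂
    s₃≤s₂ = subst (_≤ s₂)
      (sepCount-cong allOrderings (transpose-fix a≢c a≢d) (transpose-matchˡ c d)
                                  (transpose-fix b≢c b≢d) (transpose-matchʳ c d))
      (sepCount-relabel (transpose c d) a c b d)

  fracSepDim≤3 : (G : Graph n) → FracSepDim≤ G 3 1
  fracSepDim≤3 G =
    3 * m , m , (allOrderings-nonempty , L , length-copies 3 allOrderings , separatesAll) ,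
    ≤-reflexive (*-identityʳ (3 * m))
    where
    m = length allOrderings
    L = concat (replicate 3 allOrderings)
    separatesAll : SeparatesAll G m L
    separatesAll a b c d nonincident = subst (m ≤_) (sym (sepCount-copies 3 allOrderings))
      (length-allOrderings≤3*sepCount (nonincident-distinct G nonincident))

mainTheorem1 : (∀ (n : ℕ) (G : Graph n) → FracSepDim≤ G 3 1)
    × (∀ (n : ℕ) (G : Graph n) → ContainsK4 G → FracSepDim≥ G 3 1)
mainTheorem1 = (λ _ → fracSepDim≤3) , (λ _ → fracSepDim≥3)
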